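{- Let $n,r$ be positive integers with $r\geq 2$. If $\chi$ is a palindromic Gallai-Schur $r$-coloring of $[1,n]$, then $\chi^{*}=\langle \chi, r+1, \chi\rangle$ is a palindromic Gallai-Schur $(r+1)$-coloring of $[1,2n+1]$.
   Context: $[1,n]=\{1,\dots,n\}$. An $r$-coloring of $[1,n]$ is a function $\chi:[1,n]\to\{1,\dots,r\}$. Under $\chi$, a Gallai-Schur triple is a triple $(x,y,z)$ with $x,y,z\in[1,n]$, $x\leq y$, $x+y=z$, and either $\chi(x)=\chi(y)=\chi(z)$ or $\chi(x),\chi(y),\chi(z)$ pairwise distinct. $\chi$ is a Gallai-Schur coloring if it has no Gallai-Schur triple, and palindromic if $\chi(i)=\chi(n+1-i)$ for all $i\in[1,n]$. For a coloring $\chi$ of $[1,n]$ and colors $c_1,\dots,c_m$, the concatenation $\langle \chi,c_1,\chi,c_2,\dots,c_m,\chi\rangle$ is the coloring $\psi$ of $[1,(m+1)n+m]$ with $\psi(j(n+1))=c_j$ for $j\in[1,m]$ and $\psi(i+(j-1)(n+1))=\chi(i)$ for $i\in[1,n]$, $j\in[1,m+1]$. -}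

module Defs where

open import Data.Nat using (ℕ; zero; suc; _+_; _*_; _≤_; _∸_)
open import Data.Nat.DivMod using (_/_; _%_)
open import Data.List using (List; lookup; length)
open import Data.Fin using (Fin; fromℕ<)
open import Data.Nat.Properties using (_<?_)
open import Data.Product using (_×_; Σ)
open import Data.Sum using (_⊎_)
open import Relation.Binary.PropositionalEquality using (_≡_; _≢_)
open import Relation.Nullary using (¬_; yes; no)

-- A coloring of [1,n] is represented as a function ℕ → ℕ; only its values
-- on [1,n] are relevant.
Coloring : Set
Coloring = ℕ → ℕ

IsRColoring : ℕ → ℕ → Coloring → Set
IsRColoring r n χ = ∀ i → 1 ≤ i → i ≤ n → (1 ≤ χ i) × (χ i ≤ r)

GallaiSchurTriple : ℕ → Coloring → ℕ → ℕ → ℕ → Set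
GallaiSchurTriple n χ x y z =
  (1 ≤ x) × (z ≤ n) × (x ≤ y) × (x + y ≡ z) ×
  ( ((χ x ≡ χ y) × (χ y ≡ χ z))
  ⊎ ((χ x ≢ χ y) × (χ y ≢ χ z) × (χ x ≢ χ z)))

IsGallaiSchur : ℕ → Coloring → Set
IsGallaiSchur n χ = ∀ x y z → ¬ GallaiSchurTriple n χ x y z

IsPalindromic : ℕ → Coloring → Set
IsPalindromic n χ = ∀ i → 1 ≤ i → i ≤ n → χ i ≡ χ (suc n ∸ i)

-- Concatenation ⟨χ, c₁, χ, …, c_m, χ⟩ of a coloring χ of [1,n] with the
-- colors cs = c₁ … c_m, a coloring of [1,(m+1)n+m].  Writing
-- k = q(n+1) + s with 0 ≤ s ≤ n: if s = 0 (and 1 ≤ q ≤ m) the color is c_q,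
-- otherwise it is χ(s).  Values outside [1,(m+1)n+m] are irrelevant (0).
concat : ℕ → Coloring → List ℕ → Coloring
concat n χ cs k with k / suc n | k % suc n
... | q | suc s = χ (suc s)
... | zero | zero = 0
... | suc q | zero with q <? length cs
...   | yes q<m = lookup cs (fromℕ< q<m)
...   | no _ = 0

-- Split [1,2n+1] into a left copy [1,n], the separator n+1 and a right copy
-- [n+2,2n+1].  A sum x+y=z with z in the left copy is a triple of χ.  If z is
-- the separator then y = n+1-x, so χ(x) = χ(y) by palindromicity while z has a
-- fresh colour.  If z = n+1+k is in the right copy and y is in the left copy,
-- palindromicity replaces y by n+1-y and (n+1-y)+k = x is a triple of χ with
-- the same colours; if y is the separator then x = k, so x and z agree while
-- y is fresh; if y = n+1+d then x+d = k is a triple of χ.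
module Submission where

open import Defs
open import Data.Nat using (ℕ; suc; _+_; _*_; _∸_; _≤_; _<_; z<s; s≤s; s≤s⁻¹; _≤?_; _≟_)
open import Data.Nat.Properties
open import Data.Nat.DivMod using ([m+kn]%n≡m%n; m<n⇒m%n≡m; n/n≡1; n%n≡0)
open import Data.List using (_∷_; [])
open import Data.Product using (_×_; _,_; proj₂)
open import Data.Sum using (_⊎_; inj₁; inj₂)
open import Function using (_∘_)
open import Relation.Nullary using (¬_; yes; no)
open import Relation.Binary.PropositionalEquality

module _ (n : ℕ) (χ : Coloring) where

  concat-block : ∀ cs q {k} → 1 ≤ k → k ≤ n → concat n χ cs (k + q * suc n) ≡ χ k
  concat-block cs q {k@(suc _)} _ k≤n
    rewrite trans ([m+kn]%n≡m%n k q (suc n)) (m<n⇒m%n≡m (s≤s k≤n)) = refl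

  concat-left : ∀ cs {k} → 1 ≤ k → k ≤ n → concat n χ cs k ≡ χ k
  concat-left cs {k} 1≤k k≤n =
    trans (cong (concat n χ cs) (sym (+-identityʳ k))) (concat-block cs 0 1≤k k≤n)

  concat-right : ∀ cs {k} → 1 ≤ k → k ≤ n → concat n χ cs (k + suc n) ≡ χ k
  concat-right cs {k} 1≤k k≤n =
    trans (cong (λ m → concat n χ cs (k + m)) (sym (+-identityʳ (suc n))))
          (concat-block cs 1 1≤k k≤n)

  concat-separator : ∀ c cs → concat n χ (c ∷ cs) (suc n) ≡ c
  concat-separator c cs rewrite n/n≡1 (suc n) ⦃ _ ⦄ | n%n≡0 (suc n) ⦃ _ ⦄ = refl

1+2n≡n+[1+n] : ∀ n → suc (2 * n) ≡ n + suc n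
1+2n≡n+[1+n] n = trans (cong (suc ∘ (n +_)) (+-identityʳ n)) (sym (+-suc n n))

m+[1+n]≤1+2n⇒m≤n : ∀ {m n} → m + suc n ≤ suc (2 * n) → m ≤ n
m+[1+n]≤1+2n⇒m≤n {m} {n} le =
  +-cancelʳ-≤ (suc n) m n (subst (m + suc n ≤_) (1+2n≡n+[1+n] n) le)

m≤n⇒0<1+n∸m : ∀ {m n} → m ≤ n → 1 ≤ suc n ∸ m
m≤n⇒0<1+n∸m m≤n = m<n⇒0<n∸m (s≤s m≤n)

0<m⇒1+n∸m≤n : ∀ {m n} → 1 ≤ m → suc n ∸ m ≤ n
0<m⇒1+n∸m≤n {suc m} {n} _ = m∸n≤m n m

data Position (n : ℕ) : ℕ → Set where
  left   : ∀ {k} → 1 ≤ k → k ≤ n → Position n k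
  middle : Position n (suc n)
  right  : ∀ {k} → 1 ≤ k → k ≤ n → Position n (k + suc n)

position : ∀ n {k} → 1 ≤ k → k ≤ suc (2 * n) → Position n k
position n {k} 1≤k k≤2n+1 with k ≤? n
... | yes k≤n = left 1≤k k≤n
... | no k≰n with k ≟ suc n
...   | yes refl = middle
...   | no k≢n+1 = subst (Position n) k∸[1+n]+[1+n]≡k
                     (right (m<n⇒0<n∸m n+1<k)
                            (m+[1+n]≤1+2n⇒m≤n (subst (_≤ suc (2 * n)) (sym k∸[1+n]+[1+n]≡k) k≤2n+1)))
  where
  n+1<k : suc n < k
  n+1<k = ≤∧≢⇒< (≰⇒> k≰n) (k≢n+1 ∘ sym)
  k∸[1+n]+[1+n]≡k : k ∸ suc n + suc n ≡ k
  k∸[1+n]+[1+n]≡k = m∸n+n≡m (<⇒≤ n+1<k)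

MonoOrRainbow : {A : Set} → A → A → A → Set
MonoOrRainbow a b c = ((a ≡ b) × (b ≡ c)) ⊎ ((a ≢ b) × (b ≢ c) × (a ≢ c))

module _ {A : Set} {a b c : A} where

  MonoOrRainbow-swap : MonoOrRainbow a b c → MonoOrRainbow b a c
  MonoOrRainbow-swap (inj₁ (a≡b , b≡c)) = inj₁ (sym a≡b , trans a≡b b≡c)
  MonoOrRainbow-swap (inj₂ (a≢b , b≢c , a≢c)) = inj₂ (a≢b ∘ sym , a≢c , b≢c)

  MonoOrRainbow-rotate : MonoOrRainbow a b c → MonoOrRainbow b c a
  MonoOrRainbow-rotate (inj₁ (a≡b , b≡c)) = inj₁ (b≡c , sym (trans a≡b b≡c))
  MonoOrRainbow-rotate (inj₂ (a≢b , b≢c , a≢c)) = inj₂ (b≢c , a≢c ∘ sym , a≢b ∘ sym)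

  ≡∧≢⇒¬MonoOrRainbow : a ≡ b → b ≢ c → ¬ MonoOrRainbow a b c
  ≡∧≢⇒¬MonoOrRainbow _   b≢c (inj₁ (_ , b≡c))   = b≢c b≡c
  ≡∧≢⇒¬MonoOrRainbow a≡b _   (inj₂ (a≢b , _ , _)) = a≢b a≡b

MonoOrRainbow-cong : ∀ {A : Set} {a b c a′ b′ c′ : A} →
  a ≡ a′ → b ≡ b′ → c ≡ c′ → MonoOrRainbow a b c → MonoOrRainbow a′ b′ c′
MonoOrRainbow-cong refl refl refl p = p

IsGallaiSchur⇒¬MonoOrRainbow : ∀ {n χ} → IsGallaiSchur n χ → ∀ {a b c} →
  1 ≤ a → 1 ≤ b → a + b ≡ c → c ≤ n → ¬ MonoOrRainbow (χ a) (χ b) (χ c)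
IsGallaiSchur⇒¬MonoOrRainbow gs {a} {b} {c} 1≤a 1≤b a+b≡c c≤n p with ≤-total a b
... | inj₁ a≤b = gs a b c (1≤a , c≤n , a≤b , a+b≡c , p)
... | inj₂ b≤a = gs b a c (1≤b , c≤n , b≤a , trans (+-comm b a) a+b≡c , MonoOrRainbow-swap p)

1≤m∧m+n≡1+o⇒n≤o : ∀ {m n o} → 1 ≤ m → m + n ≡ suc o → n ≤ o
1≤m∧m+n≡1+o⇒n≤o {m} {n} 1≤m e = s≤s⁻¹ (subst (suc n ≤_) e (+-monoˡ-≤ n 1≤m))

module Doubling (n : ℕ) (χ : Coloring) (c : ℕ) where

  χ* : Coloring
  χ* = concat n χ (c ∷ [])

  χ*-left : ∀ {k} → 1 ≤ k → k ≤ n → χ* k ≡ χ k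
  χ*-left = concat-left n χ (c ∷ [])

  χ*-right : ∀ {k} → 1 ≤ k → k ≤ n → χ* (k + suc n) ≡ χ k
  χ*-right = concat-right n χ (c ∷ [])

  χ*-separator : χ* (suc n) ≡ c
  χ*-separator = concat-separator n χ c []

  module _ (pal : IsPalindromic n χ) where

    χ*-mirror : ∀ {i} → Position n i → χ* i ≡ χ* ((suc n + suc n) ∸ i)
    χ*-mirror {i} (left 1≤i i≤n) = begin
      χ* i                          ≡⟨ χ*-left 1≤i i≤n ⟩
      χ i                           ≡⟨ pal i 1≤i i≤n ⟩
      χ (suc n ∸ i)                 ≡⟨ χ*-right (m≤n⇒0<1+n∸m i≤n) (0<m⇒1+n∸m≤n 1≤i) ⟨
      χ* ((suc n ∸ i) + suc n)      ≡⟨ cong χ* (+-∸-comm (suc n) (m≤n⇒m≤1+n i≤n)) ⟨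
      χ* ((suc n + suc n) ∸ i)      ∎
      where open ≡-Reasoning
    χ*-mirror middle = cong χ* (sym (m+n∸m≡n (suc n) (suc n)))
    χ*-mirror {_} (right {k} 1≤k k≤n) = begin
      χ* (k + suc n)                     ≡⟨ χ*-right 1≤k k≤n ⟩
      χ k                                ≡⟨ pal k 1≤k k≤n ⟩
      χ (suc n ∸ k)                      ≡⟨ χ*-left (m≤n⇒0<1+n∸m k≤n) (0<m⇒1+n∸m≤n 1≤k) ⟨
      χ* (suc n ∸ k)                     ≡⟨ cong χ* ([m+n]∸[m+o]≡n∸o (suc n) (suc n) k) ⟨
      χ* ((suc n + suc n) ∸ (suc n + k)) ≡⟨ cong (λ m → χ* ((suc n + suc n) ∸ m)) (+-comm (suc n) k) ⟩
      χ* ((suc n + suc n) ∸ (k + suc n)) ∎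
      where open ≡-Reasoning

    χ*-palindromic : IsPalindromic (suc (2 * n)) χ*
    χ*-palindromic i 1≤i i≤2n+1 =
      trans (χ*-mirror (position n 1≤i i≤2n+1))
            (cong (λ m → χ* (suc m ∸ i)) (sym (1+2n≡n+[1+n] n)))

    module _ (gs : IsGallaiSchur n χ) (fresh : ∀ i → 1 ≤ i → i ≤ n → χ i ≢ c) where

      ¬χ-pattern : ∀ {a b d} → 1 ≤ a → 1 ≤ b → a + b ≡ d → d ≤ n → ¬ MonoOrRainbow (χ a) (χ b) (χ d)
      ¬χ-pattern = IsGallaiSchur⇒¬MonoOrRainbow gs

      sum-in-left : ∀ {x y z} → 1 ≤ x → x ≤ n → 1 ≤ y → y ≤ n → x + y ≡ z → z ≤ n →
        ¬ MonoOrRainbow (χ* x) (χ* y) (χ* z)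
      sum-in-left {x} {y} 1≤x x≤n 1≤y y≤n e z≤n′ =
        ¬χ-pattern 1≤x 1≤y e z≤n′
        ∘ MonoOrRainbow-cong (χ*-left 1≤x x≤n) (χ*-left 1≤y y≤n)
                             (χ*-left (≤-trans 1≤x (subst (x ≤_) e (m≤m+n x y))) z≤n′)

      sum-at-separator : ∀ {x y} → 1 ≤ x → 1 ≤ y → x + y ≡ suc n →
        ¬ MonoOrRainbow (χ* x) (χ* y) (χ* (suc n))
      sum-at-separator {x} {y} 1≤x 1≤y e =
        ≡∧≢⇒¬MonoOrRainbow χx≡χy (fresh y 1≤y y≤n)
        ∘ MonoOrRainbow-cong (χ*-left 1≤x x≤n) (χ*-left 1≤y y≤n) χ*-separator
        where
        x≤n : x ≤ n
        x≤n = 1≤m∧m+n≡1+o⇒n≤o 1≤y (trans (+-comm y x) e)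
        y≤n : y ≤ n
        y≤n = 1≤m∧m+n≡1+o⇒n≤o 1≤x e
        χx≡χy : χ x ≡ χ y
        χx≡χy = trans (pal x 1≤x x≤n) (cong χ (trans (cong (_∸ x) (sym e)) (m+n∸m≡n x y)))

      sum-in-right : ∀ {x y k} → 1 ≤ x → x ≤ n → 1 ≤ y → y ≤ n → 1 ≤ k → k ≤ n →
        x + y ≡ k + suc n → ¬ MonoOrRainbow (χ* x) (χ* y) (χ* (k + suc n))
      sum-in-right {x} {y} {k} 1≤x x≤n 1≤y y≤n 1≤k k≤n e =
        ¬χ-pattern (m≤n⇒0<1+n∸m y≤n) 1≤k y′+k≡x x≤n
        ∘ MonoOrRainbow-rotate
        ∘ MonoOrRainbow-cong (χ*-left 1≤x x≤n) (trans (χ*-left 1≤y y≤n) (pal y 1≤y y≤n))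
                             (χ*-right 1≤k k≤n)
        where
        open ≡-Reasoning
        y′ : ℕ
        y′ = suc n ∸ y
        y′+k≡x : y′ + k ≡ x
        y′+k≡x = trans (+-comm y′ k) (sym (+-cancelʳ-≡ y x (k + y′) (begin
          x + y              ≡⟨ e ⟩
          k + suc n          ≡⟨ cong (k +_) (m∸n+n≡m (m≤n⇒m≤1+n y≤n)) ⟨
          k + (y′ + y)       ≡⟨ +-assoc k y′ y ⟨
          k + y′ + y         ∎)))

      separator-summand : ∀ {x} → 1 ≤ x → x + suc n ≤ suc (2 * n) →
        ¬ MonoOrRainbow (χ* x) (χ* (suc n)) (χ* (x + suc n))
      separator-summand {x} 1≤x bound =
        ≡∧≢⇒¬MonoOrRainbow refl (fresh x 1≤x x≤n)
        ∘ MonoOrRainbow-rotate ∘ MonoOrRainbow-rotate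
        ∘ MonoOrRainbow-cong (χ*-left 1≤x x≤n) χ*-separator (χ*-right 1≤x x≤n)
        where
        x≤n : x ≤ n
        x≤n = m+[1+n]≤1+2n⇒m≤n bound

      right-summand : ∀ {x d} → 1 ≤ x → 1 ≤ d → d ≤ n → x + (d + suc n) ≤ suc (2 * n) →
        ¬ MonoOrRainbow (χ* x) (χ* (d + suc n)) (χ* (x + (d + suc n)))
      right-summand {x} {d} 1≤x 1≤d d≤n bound =
        ¬χ-pattern 1≤x 1≤d refl x+d≤n
        ∘ MonoOrRainbow-cong (χ*-left 1≤x (≤-trans (m≤m+n x d) x+d≤n)) (χ*-right 1≤d d≤n)
                             (trans (cong χ* reassoc) (χ*-right (≤-trans 1≤x (m≤m+n x d)) x+d≤n))
        where
        reassoc : x + (d + suc n) ≡ x + d + suc n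
        reassoc = sym (+-assoc x d (suc n))
        x+d≤n : x + d ≤ n
        x+d≤n = m+[1+n]≤1+2n⇒m≤n (subst (_≤ suc (2 * n)) reassoc bound)

      left-summand : ∀ {x y z} → 1 ≤ x → x ≤ n → 1 ≤ y → y ≤ n → x + y ≡ z → Position n z →
        ¬ MonoOrRainbow (χ* x) (χ* y) (χ* z)
      left-summand 1≤x x≤n 1≤y y≤n e (left _ z≤n′)   = sum-in-left 1≤x x≤n 1≤y y≤n e z≤n′
      left-summand 1≤x _   1≤y _   e middle           = sum-at-separator 1≤x 1≤y e
      left-summand 1≤x x≤n 1≤y y≤n e (right 1≤k k≤n) = sum-in-right 1≤x x≤n 1≤y y≤n 1≤k k≤n e

      ¬χ*-pattern : ∀ {x y z} → 1 ≤ x → x ≤ y → x + y ≡ z → z ≤ suc (2 * n) → Position n y →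
        ¬ MonoOrRainbow (χ* x) (χ* y) (χ* z)
      ¬χ*-pattern {x} {y} 1≤x x≤y e z≤ (left 1≤y y≤n) =
        left-summand 1≤x (≤-trans x≤y y≤n) 1≤y y≤n e
          (position n (≤-trans 1≤y (subst (y ≤_) e (m≤n+m y x))) z≤)
      ¬χ*-pattern 1≤x _ refl z≤ middle          = separator-summand 1≤x z≤
      ¬χ*-pattern 1≤x _ refl z≤ (right 1≤d d≤n) = right-summand 1≤x 1≤d d≤n z≤

      χ*-gallaiSchur : IsGallaiSchur (suc (2 * n)) χ*
      χ*-gallaiSchur x y z (1≤x , z≤2n+1 , x≤y , e , p) =
        ¬χ*-pattern 1≤x x≤y e z≤2n+1
          (position n (≤-trans 1≤x x≤y) (≤-trans (subst (y ≤_) e (m≤n+m y x)) z≤2n+1)) p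

concat-isRColoring : ∀ {r n χ} → IsRColoring r n χ →
  IsRColoring (suc r) (suc (2 * n)) (concat n χ (suc r ∷ []))
concat-isRColoring {r} {n} {χ} rc i 1≤i i≤2n+1 = bounds (position n 1≤i i≤2n+1)
  where
  open Doubling n χ (suc r)
  bounds : ∀ {k} → Position n k → 1 ≤ χ* k × χ* k ≤ suc r
  bounds (left 1≤k k≤n) rewrite χ*-left 1≤k k≤n =
    let (1≤χk , χk≤r) = rc _ 1≤k k≤n in 1≤χk , m≤n⇒m≤1+n χk≤r
  bounds middle rewrite χ*-separator = z<s , ≤-refl
  bounds (right 1≤k k≤n) rewrite χ*-right 1≤k k≤n =
    let (1≤χk , χk≤r) = rc _ 1≤k k≤n in 1≤χk , m≤n⇒m≤1+n χk≤r

IsRColoring⇒≢suc : ∀ {r n χ} → IsRColoring r n χ → ∀ i → 1 ≤ i → i ≤ n → χ i ≢ suc r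
IsRColoring⇒≢suc {r} rc i 1≤i i≤n χi≡1+r = 1+n≰n (subst (_≤ r) χi≡1+r (proj₂ (rc i 1≤i i≤n)))

lemma2p1 : (n r : ℕ) → 1 ≤ n → 2 ≤ r → (χ : Coloring) →
    IsRColoring r n χ → IsGallaiSchur n χ → IsPalindromic n χ →
    IsRColoring (suc r) (suc (2 * n)) (concat n χ (suc r ∷ [])) ×
    IsGallaiSchur (suc (2 * n)) (concat n χ (suc r ∷ [])) ×
    IsPalindromic (suc (2 * n)) (concat n χ (suc r ∷ []))
lemma2p1 n r _ _ χ rc gs pal =
  concat-isRColoring rc ,
  χ*-gallaiSchur pal gs (IsRColoring⇒≢suc rc) ,
  χ*-palindromic pal
  where open Doubling n χ (suc r)
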